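{- Let $H$ be a bipartite graph with $\chi(H)=2$ and ${\rm hcf}_c(H)=1$, and let $B^*$ be its bottlegraph. There exists $D_0$ (depending on $H$) such that the following holds for every integer $D'\ge D_0$ divisible by $|H|$. Let $a$ be an integer with $|a|\le|B^*|$ and let $G$ be the disjoint union of two cliques of orders $D'+a$ and $D'-a$. Then $G$ contains a perfect $H$-packing.
   Context: ${\rm hcf}_c(H)$ is the highest common factor of the orders of the connected components of $H$. $\sigma(H)$ is the minimum, over proper $2$-colourings of $H$, of the size of a smaller colour class; the bottlegraph $B^*$ is the complete bipartite graph with classes of sizes $\sigma(H)$ and $|H|-\sigma(H)$ (so $|B^*|=|H|$). A perfect $H$-packing is a collection of vertex-disjoint copies of $H$ covering all vertices. -}

module Defs where

open import Data.Nat using (ℕ; zero; suc; _≡ᵇ_)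
open import Data.Nat.GCD using (gcd)
open import Data.Fin using (Fin; toℕ)
open import Data.Bool using (Bool; true; false; _∧_; _∨_)
open import Data.List using (List; length; filterᵇ; allFin; map; foldr)
open import Data.Bool.ListAction using (any)
open import Data.Sum using (_⊎_; inj₁; inj₂)
open import Data.Product using (Σ; ∃; _×_)
open import Data.Empty using (⊥)
open import Relation.Nullary using (¬_)
open import Relation.Binary.PropositionalEquality using (_≡_; _≢_)

record Graph : Set where
  field
    order  : ℕ
    adj    : Fin order → Fin order → Bool
    sym    : ∀ x y → adj x y ≡ adj y x
    irrefl : ∀ x → adj x x ≡ false
open Graph public

Colourable : Graph → ℕ → Set
Colourable H k = Σ (Fin (order H) → Fin k) λ c →
  ∀ x y → adj H x y ≡ true → c x ≢ c y

χ≡ : Graph → ℕ → Set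
χ≡ H zero    = Colourable H zero
χ≡ H (suc k) = Colourable H (suc k) × ¬ Colourable H k

reach : (H : Graph) → ℕ → Fin (order H) → Fin (order H) → Bool
reach H zero    v u = toℕ v ≡ᵇ toℕ u
reach H (suc k) v u =
  reach H k v u ∨ any (λ w → reach H k v w ∧ adj H w u) (allFin (order H))

-- u and v lie in the same connected component (a walk of length ≤ |H| suffices)
connected : (H : Graph) → Fin (order H) → Fin (order H) → Bool
connected H = reach H (order H)

componentOrder : (H : Graph) → Fin (order H) → ℕ
componentOrder H v = length (filterᵇ (connected H v) (allFin (order H)))

-- hcf_c(H): gcd of the orders of the connected components
-- (each component is listed once per vertex; repetitions do not change the gcd)
hcf-c : Graph → ℕ
hcf-c H = foldr gcd 0 (map (componentOrder H) (allFin (order H)))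

bottleOrder : Graph → ℕ
bottleOrder H = order H

TwoCliques : ℕ → ℕ → Set
TwoCliques m₁ m₂ = Fin m₁ ⊎ Fin m₂

twoCliquesAdj : ∀ {m₁ m₂} → TwoCliques m₁ m₂ → TwoCliques m₁ m₂ → Set
twoCliquesAdj (inj₁ x) (inj₁ y) = x ≢ y
twoCliquesAdj (inj₁ x) (inj₂ y) = ⊥
twoCliquesAdj (inj₂ x) (inj₁ y) = ⊥
twoCliquesAdj (inj₂ x) (inj₂ y) = x ≢ y

PerfectPacking : (H : Graph) (V : Set) (E : V → V → Set) → Set
PerfectPacking H V E = Σ ℕ λ k → Σ (Fin k → Fin (order H) → V) λ φ →
  (∀ i x y → adj H x y ≡ true → E (φ i x) (φ i y)) ×
  (∀ i j x y → φ i x ≡ φ j y → (i ≡ j) × (x ≡ y)) ×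
  (∀ v → Σ (Fin k) λ i → Σ (Fin (order H)) λ x → φ i x ≡ v)

-- A copy of H fits into K_m₁ ⊔ K_m₂ with any union of its components in the first clique and
-- the rest in the second.  Call s attainable if K_(D+s) ⊔ K_(D-s) has a perfect H-packing for
-- some D divisible by |H|.  One whole copy in the first clique together with one copy split as
-- (component C, rest) attains s = |C|; disjoint unions of packings add (D, s), and exchanging
-- the cliques negates s.  So the attainable shifts form a subgroup of ℤ containing every
-- component order, hence, by Bézout, containing hcf_c(H) = 1, say with D = D₁.  Scaling that
-- packing by |a| ≤ |H| and padding with pairs of whole copies, one in each clique, reaches every
-- D′ ≥ |H| D₁ divisible by |H|.

module Submission where

open import Defs renaming (sym to adj-sym)
open import Data.Nat as ℕ using (ℕ; zero; suc; _≤_; _<_; _≥_; _∸_; s≤s)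
open import Data.Nat.Properties as ℕ using (≤-trans; <⇒≱; n≤1+n; m∸n+n≡m; m+[n∸m]≡n; *-monoˡ-≤)
open import Data.Nat.Divisibility using (_∣_; divides; _∣0; ∣-refl; ∣m∣n⇒∣m+n; ∣m+n∣m⇒∣n; ∣n⇒∣m*n)
open import Data.Nat.GCD using (gcd; gcd-GCD; module Bézout)
open import Data.Integer as ℤ using (ℤ; +_; -[1+_]; _+_; _-_; -_; _*_; ∣_∣; _⊖_; 0ℤ; 1ℤ)
open import Data.Integer.Properties as ℤ using (pos-+; pos-*; +-injective; suc-*; neg-involutive; ⊖-≥; m-n≡m⊖n)
open import Data.Integer.Tactic.RingSolver using (solve-∀)
open import Data.Fin using (Fin; zero; suc; toℕ; _↑ˡ_; _↑ʳ_; splitAt; join)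
open import Data.Fin.Properties using (+↔⊎; splitAt-↑ˡ; splitAt-↑ʳ; join-splitAt; ↑ˡ-injective; ↑ʳ-injective)
open import Data.Fin.Subset as Subset using (Subset; Side; inside; outside; _∈_; _⊆_; _⊂_; ∁) renaming (∣_∣ to ∣_∣ˢ)
open import Data.Fin.Subset.Properties using (_∈?_; ⊆-antisym; ⊥⊆; ∉⊥; ∣⊥∣≡0; ∣⊤∣≡n; ∣p∣≤n; p⊂q⇒∣p∣<∣q∣; _⊂?_; ∣∁p∣≡n∸∣p∣; ∈⊤)
open import Data.Vec using ([]; _∷_; lookup; tabulate)
open import Data.Vec.Properties using (lookup∘tabulate; tabulate-cong; []=⇒lookup; lookup⇒[]=)
open import Data.Bool using (Bool; true; false; _∨_; _∧_)
open import Data.Bool.Properties using (T-≡; ⇔→≡; ∨-zeroʳ)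
open import Data.Bool.ListAction using (any; or)
open import Data.List as List using (length; filterᵇ; allFin; foldr)
open import Data.List.Properties using (map-cong)
open import Data.List.Membership.Propositional using (lose)
open import Data.List.Membership.Propositional.Properties using (∈-allFin)
open import Data.List.Relation.Unary.All as All using (All; []; _∷_)
open import Data.List.Relation.Unary.All.Properties using (map⁺)
open import Data.List.Relation.Unary.Any.Properties using (any⁺)
open import Data.Sum as Sum using (_⊎_; inj₁; inj₂; [_,_]′; swap)
open import Data.Sum.Properties using (inj₁-injective; inj₂-injective)
open import Data.Sum.Algebra using (⊎-comm)
open import Data.Sum.Relation.Binary.Pointwise using (Pointwise; inj₁; inj₂)
open import Data.Product as Product using (Σ; _×_; _,_)
open import Data.Empty using (⊥-elim)
open import Function using (_∘_; _$_; id; const; _⇔_; mk⇔; Equivalence)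
open import Function.Bundles using (_↔_; Inverse; Injection; mk↔ₛ′)
open import Function.Properties.Inverse using (↔-sym; ↔-trans; ↔⇒↣)
open import Relation.Nullary using (¬_; yes; no)
open import Relation.Nullary.Decidable using (decidable-stable)
open import Relation.Binary.PropositionalEquality using (_≡_; _≢_; refl; sym; trans; cong; cong₂; subst; subst₂; module ≡-Reasoning)

open Inverse using (to; from; strictlyInverseˡ; strictlyInverseʳ)

private
  variable
    I J V W : Set
    E : V → V → Set
    F : W → W → Set
    n a b a′ b′ D D′ m₁ m₂ : ℕ
    i j i′ j′ s s′ : ℤ

↔-injective : (e : V ↔ W) {x y : V} → to e x ≡ to e y → x ≡ y
↔-injective e = Injection.injective (↔⇒↣ e)

∈-tabulate⁺ : {f : Fin n → Bool} {x : Fin n} → f x ≡ true → x ∈ tabulate f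
∈-tabulate⁺ {f = f} {x} fx = lookup⇒[]= x (tabulate f) (trans (lookup∘tabulate f x) fx)

⊆∧⊄⇒≡ : {p q : Subset n} → p ⊆ q → ¬ p ⊂ q → p ≡ q
⊆∧⊄⇒≡ {p = p} p⊆q p⊄q = ⊆-antisym p⊆q λ {x} x∈q →
  decidable-stable (x ∈? p) λ x∉p → p⊄q (p⊆q , x , x∈q , x∉p)

+∣∁p∣≡n-∣p∣ : (p : Subset n) → + ∣ ∁ p ∣ˢ ≡ + n - + ∣ p ∣ˢ
+∣∁p∣≡n-∣p∣ {n} p = begin
  + ∣ ∁ p ∣ˢ       ≡⟨ cong +_ (∣∁p∣≡n∸∣p∣ p) ⟩
  + (n ∸ ∣ p ∣ˢ)   ≡⟨ ⊖-≥ (∣p∣≤n p) ⟨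
  n ⊖ ∣ p ∣ˢ       ≡⟨ m-n≡m⊖n n ∣ p ∣ˢ ⟨
  + n - + ∣ p ∣ˢ   ∎
  where open ≡-Reasoning

length-filterᵇ-tabulate : {A : Set} (P : A → Bool) (g : Fin n → A) →
  length (filterᵇ P (List.tabulate g)) ≡ ∣ tabulate (P ∘ g) ∣ˢ
length-filterᵇ-tabulate {zero}  P g = refl
length-filterᵇ-tabulate {suc n} P g with P (g zero)
... | true  = cong suc (length-filterᵇ-tabulate P (g ∘ suc))
... | false = length-filterᵇ-tabulate P (g ∘ suc)

-- A step that changes S enlarges it, which can happen fewer than n times as S 0 is nonempty;
-- once a step fixes S, all later steps do.
module _ (step : Subset n → Subset n) (step-inflationary : ∀ p → p ⊆ step p)
         (S : ℕ → Subset n) (S-suc : ∀ k → S (suc k) ≡ step (S k)) where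

  private
    S-stable-from : ∀ {j} → S j ≡ S (suc j) → ∀ d → S (d ℕ.+ j) ≡ S (suc (d ℕ.+ j))
    S-stable-from Sj≡ zero    = Sj≡
    S-stable-from Sj≡ (suc d) =
      trans (S-suc _) (trans (cong step (S-stable-from Sj≡ d)) (sym (S-suc _)))

    S-growth : ∀ {x} → x ∈ S 0 → ∀ k → (Σ ℕ λ j → j ≤ k × S j ≡ S (suc j)) ⊎ (k < ∣ S k ∣ˢ)
    S-growth x∈S₀ zero = inj₂ (subst (_< ∣ S 0 ∣ˢ) (∣⊥∣≡0 n) (p⊂q⇒∣p∣<∣q∣ (⊥⊆ , _ , x∈S₀ , ∉⊥)))
    S-growth x∈S₀ (suc k) with S-growth x∈S₀ k | S k ⊂? S (suc k)
    ... | inj₁ (j , j≤k , stable) | _      = inj₁ (j , ≤-trans j≤k (n≤1+n k) , stable)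
    ... | inj₂ k<∣Sk∣            | yes ⊂ = inj₂ (≤-trans (s≤s k<∣Sk∣) (p⊂q⇒∣p∣<∣q∣ ⊂))
    ... | inj₂ _                  | no ⊄  = inj₁ (k , n≤1+n k , ⊆∧⊄⇒≡ Sk⊆ ⊄)
      where
      Sk⊆ : S k ⊆ S (suc k)
      Sk⊆ = subst (S k ⊆_) (sym (S-suc k)) (step-inflationary (S k))

  iterate-stabilises : ∀ {x} → x ∈ S 0 → S n ≡ S (suc n)
  iterate-stabilises x∈S₀ with S-growth x∈S₀ n
  ... | inj₁ (j , j≤n , stable) =
    subst (λ m → S m ≡ S (suc m)) (m∸n+n≡m j≤n) (S-stable-from stable (n ∸ j))
  ... | inj₂ n<∣Sn∣             = ⊥-elim (<⇒≱ n<∣Sn∣ (∣p∣≤n (S n)))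

bézout-ℤ : ∀ {d} x a y b → d ℕ.+ y ℕ.* b ≡ x ℕ.* a → + x * + a - + y * + b ≡ + d
bézout-ℤ {d} x a y b eq = begin
  + x * + a - + y * + b               ≡⟨ cong₂ _-_ (pos-* x a) (pos-* y b) ⟨
  + (x ℕ.* a) - + (y ℕ.* b)           ≡⟨ cong (λ z → + z - + (y ℕ.* b)) eq ⟨
  + (d ℕ.+ y ℕ.* b) - + (y ℕ.* b)     ≡⟨ cong (_- + (y ℕ.* b)) (pos-+ d (y ℕ.* b)) ⟩
  + d + + (y ℕ.* b) - + (y ℕ.* b)     ≡⟨ i+j-j≡i (+ d) (+ (y ℕ.* b)) ⟩
  + d                                 ∎
  where
  open ≡-Reasoning
  i+j-j≡i : ∀ i j → i + j - j ≡ i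
  i+j-j≡i = solve-∀

module _ {ℓ} (S : ℤ → Set ℓ) (S-0 : S 0ℤ) (S-+ : ∀ {i j} → S i → S j → S (i + j))
         (S-neg : ∀ {i} → S i → S (- i)) where

  subgroup-* : ∀ k {i} → S i → S (+ k * i)
  subgroup-* zero    _  = S-0
  subgroup-* (suc k) Si = subst S (sym (suc-* (+ k) _)) (S-+ Si (subgroup-* k Si))

  subgroup-gcd : ∀ {a b} → S (+ a) → S (+ b) → S (+ gcd a b)
  subgroup-gcd {a} {b} Sa Sb with Bézout.identity (gcd-GCD a b)
  ... | Bézout.+- x y eq =
    subst S (bézout-ℤ x a y b eq) (S-+ (subgroup-* x Sa) (S-neg (subgroup-* y Sb)))
  ... | Bézout.-+ x y eq =
    subst S (bézout-ℤ y b x a eq) (S-+ (subgroup-* y Sb) (S-neg (subgroup-* x Sa)))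

  subgroup-foldr-gcd : ∀ {ns} → All (S ∘ +_) ns → S (+ foldr gcd 0 ns)
  subgroup-foldr-gcd []         = S-0
  subgroup-foldr-gcd (Sn ∷ Sns) = subgroup-gcd Sn (subgroup-foldr-gcd Sns)

side : TwoCliques a b → Side
side = [ const inside , const outside ]′

sameSide⇒twoCliquesAdj : (p q : TwoCliques a b) → side p ≡ side q → p ≢ q → twoCliquesAdj p q
sameSide⇒twoCliquesAdj (inj₁ x) (inj₁ y) _ p≢q = p≢q ∘ cong inj₁
sameSide⇒twoCliquesAdj (inj₂ x) (inj₂ y) _ p≢q = p≢q ∘ cong inj₂

twoCliquesAdj-swap : {p q : TwoCliques a b} → twoCliquesAdj p q → twoCliquesAdj (swap p) (swap q)
twoCliquesAdj-swap {p = inj₁ _} {inj₁ _} = id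
twoCliquesAdj-swap {p = inj₂ _} {inj₂ _} = id

twoCliques-+↔ : (TwoCliques a b ⊎ TwoCliques a′ b′) ↔ TwoCliques (a ℕ.+ a′) (b ℕ.+ b′)
twoCliques-+↔ {a} {b} {a′} {b′} = mk↔ₛ′ merge split merge∘split split∘merge
  where
  merge : TwoCliques a b ⊎ TwoCliques a′ b′ → TwoCliques (a ℕ.+ a′) (b ℕ.+ b′)
  merge = [ Sum.map (_↑ˡ a′) (_↑ˡ b′) , Sum.map (a ↑ʳ_) (b ↑ʳ_) ]′
  split : TwoCliques (a ℕ.+ a′) (b ℕ.+ b′) → TwoCliques a b ⊎ TwoCliques a′ b′
  split = [ Sum.map inj₁ inj₁ ∘ splitAt a , Sum.map inj₂ inj₂ ∘ splitAt b ]′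
  merge∘split : ∀ p → merge (split p) ≡ p
  merge∘split (inj₁ x) = trans (merge-inj₁ (splitAt a x)) (cong inj₁ (join-splitAt a a′ x))
    where
    merge-inj₁ : ∀ s → merge (Sum.map inj₁ inj₁ s) ≡ inj₁ (join a a′ s)
    merge-inj₁ (inj₁ _) = refl
    merge-inj₁ (inj₂ _) = refl
  merge∘split (inj₂ y) = trans (merge-inj₂ (splitAt b y)) (cong inj₂ (join-splitAt b b′ y))
    where
    merge-inj₂ : ∀ s → merge (Sum.map inj₂ inj₂ s) ≡ inj₂ (join b b′ s)
    merge-inj₂ (inj₁ _) = refl
    merge-inj₂ (inj₂ _) = refl
  split∘merge : ∀ p → split (merge p) ≡ p
  split∘merge (inj₁ (inj₁ x)) = cong (Sum.map inj₁ inj₁) (splitAt-↑ˡ a x a′)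
  split∘merge (inj₁ (inj₂ y)) = cong (Sum.map inj₂ inj₂) (splitAt-↑ˡ b y b′)
  split∘merge (inj₂ (inj₁ x)) = cong (Sum.map inj₁ inj₁) (splitAt-↑ʳ a a′ x)
  split∘merge (inj₂ (inj₂ y)) = cong (Sum.map inj₂ inj₂) (splitAt-↑ʳ b b′ y)

twoCliquesAdj-+↔ : ∀ {p q : TwoCliques a b ⊎ TwoCliques a′ b′} →
  Pointwise twoCliquesAdj twoCliquesAdj p q → twoCliquesAdj (to twoCliques-+↔ p) (to twoCliques-+↔ q)
twoCliquesAdj-+↔ {a′ = a′} {p = inj₁ (inj₁ x)} {inj₁ (inj₁ y)} (inj₁ x≢y) = x≢y ∘ ↑ˡ-injective a′ x y
twoCliquesAdj-+↔ {b′ = b′} {p = inj₁ (inj₂ x)} {inj₁ (inj₂ y)} (inj₁ x≢y) = x≢y ∘ ↑ˡ-injective b′ x y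
twoCliquesAdj-+↔ {a = a} {p = inj₂ (inj₁ x)} {inj₂ (inj₁ y)} (inj₂ x≢y) = x≢y ∘ ↑ʳ-injective a x y
twoCliquesAdj-+↔ {b = b} {p = inj₂ (inj₂ x)} {inj₂ (inj₂ y)} (inj₂ x≢y) = x≢y ∘ ↑ʳ-injective b x y

↔-sucˡ : Fin n ↔ (Fin a ⊎ Fin b) → Fin (suc n) ↔ (Fin (suc a) ⊎ Fin b)
↔-sucˡ {n} {a} {b} e = mk↔ₛ′ f g f∘g g∘f
  where
  f : Fin (suc n) → Fin (suc a) ⊎ Fin b
  f zero    = inj₁ zero
  f (suc x) = Sum.map₁ suc (to e x)
  g : Fin (suc a) ⊎ Fin b → Fin (suc n)
  g (inj₁ zero)    = zero
  g (inj₁ (suc i)) = suc (from e (inj₁ i))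
  g (inj₂ j)       = suc (from e (inj₂ j))
  g∘map₁suc : ∀ s → g (Sum.map₁ suc s) ≡ suc (from e s)
  g∘map₁suc (inj₁ _) = refl
  g∘map₁suc (inj₂ _) = refl
  f∘g : ∀ s → f (g s) ≡ s
  f∘g (inj₁ zero)    = refl
  f∘g (inj₁ (suc i)) = cong (Sum.map₁ suc) (strictlyInverseˡ e (inj₁ i))
  f∘g (inj₂ j)       = cong (Sum.map₁ suc) (strictlyInverseˡ e (inj₂ j))
  g∘f : ∀ x → g (f x) ≡ x
  g∘f zero    = refl
  g∘f (suc x) = trans (g∘map₁suc (to e x)) (cong suc (strictlyInverseʳ e x))

↔-sucʳ : Fin n ↔ (Fin a ⊎ Fin b) → Fin (suc n) ↔ (Fin a ⊎ Fin (suc b))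
↔-sucʳ e = ↔-trans (↔-sucˡ (↔-trans e (⊎-comm _ _))) (⊎-comm _ _)

partition : (p : Subset n) → Fin n ↔ TwoCliques ∣ p ∣ˢ ∣ ∁ p ∣ˢ
partition []            = mk↔ₛ′ (λ ()) [ (λ ()) , (λ ()) ]′ (λ { (inj₁ ()) ; (inj₂ ()) }) (λ ())
partition (inside ∷ p)  = ↔-sucˡ (partition p)
partition (outside ∷ p) = ↔-sucʳ (partition p)

side-partition : (p : Subset n) (x : Fin n) → side (to (partition p) x) ≡ lookup p x
side-partition (inside ∷ p)  zero    = refl
side-partition (outside ∷ p) zero    = refl
side-partition (inside ∷ p)  (suc x) = trans (side-map₁ (to (partition p) x)) (side-partition p x)
  where
  side-map₁ : (s : TwoCliques a b) → side (Sum.map₁ suc s) ≡ side s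
  side-map₁ (inj₁ _) = refl
  side-map₁ (inj₂ _) = refl
side-partition (outside ∷ p) (suc x) = trans (side-map₂ (to (partition p) x)) (side-partition p x)
  where
  side-map₂ : (s : TwoCliques a b) → side (swap (Sum.map₁ suc (swap s))) ≡ side s
  side-map₂ (inj₁ _) = refl
  side-map₂ (inj₂ _) = refl

module _ (H : Graph) where

  record Packing (I V : Set) (E : V → V → Set) : Set where
    field
      copy           : I → Fin (order H) → V
      copy-edge      : ∀ i x y → adj H x y ≡ true → E (copy i x) (copy i y)
      copy-injective : ∀ i j x y → copy i x ≡ copy j y → (i ≡ j) × (x ≡ y)
      copy-cover     : ∀ v → Σ I λ i → Σ (Fin (order H)) λ x → copy i x ≡ v
  open Packing

  packing⇒perfectPacking : ∀ {k} → Packing (Fin k) V E → PerfectPacking H V E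
  packing⇒perfectPacking P = _ , copy P , copy-edge P , copy-injective P , copy-cover P

  packing-⊎ : Packing I V E → Packing J W F → Packing (I ⊎ J) (V ⊎ W) (Pointwise E F)
  packing-⊎ P Q = record
    { copy           = λ { (inj₁ i) x → inj₁ (copy P i x) ; (inj₂ j) x → inj₂ (copy Q j x) }
    ; copy-edge      = λ { (inj₁ i) x y xy → inj₁ (copy-edge P i x y xy)
                         ; (inj₂ j) x y xy → inj₂ (copy-edge Q j x y xy) }
    ; copy-injective = λ
      { (inj₁ i) (inj₁ j) x y eq →
          Product.map₁ (cong inj₁) (copy-injective P i j x y (inj₁-injective eq))
      ; (inj₂ i) (inj₂ j) x y eq →
          Product.map₁ (cong inj₂) (copy-injective Q i j x y (inj₂-injective eq)) }
    ; copy-cover     = λ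
      { (inj₁ v) → let i , x , eq = copy-cover P v in inj₁ i , x , cong inj₁ eq
      ; (inj₂ w) → let j , x , eq = copy-cover Q w in inj₂ j , x , cong inj₂ eq }
    }

  packing-reindex : I ↔ J → Packing I V E → Packing J V E
  packing-reindex e P = record
    { copy           = copy P ∘ from e
    ; copy-edge      = copy-edge P ∘ from e
    ; copy-injective = λ i j x y → Product.map₁ (↔-injective (↔-sym e)) ∘ copy-injective P _ _ x y
    ; copy-cover     = λ v → let i , x , eq = copy-cover P v in
        to e i , x , trans (cong (λ i → copy P i x) (strictlyInverseʳ e i)) eq
    }

  packing-map : (e : V ↔ W) → (∀ {x y} → E x y → F (to e x) (to e y)) →
    Packing I V E → Packing I W F
  packing-map e e-edge P = record
    { copy           = λ i → to e ∘ copy P i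
    ; copy-edge      = λ i x y → e-edge ∘ copy-edge P i x y
    ; copy-injective = λ i j x y → copy-injective P i j x y ∘ ↔-injective e
    ; copy-cover     = λ w → let i , x , eq = copy-cover P (from e w) in
        i , x , trans (cong (to e) eq) (strictlyInverseˡ e w)
    }

  packing-self : Packing (Fin 1) (Fin (order H)) (λ x y → adj H x y ≡ true)
  packing-self = record
    { copy           = λ _ → id
    ; copy-edge      = λ _ _ _ → id
    ; copy-injective = λ { zero zero _ _ x≡y → refl , x≡y }
    ; copy-cover     = λ x → zero , x , refl
    }

  packing-∅ : ¬ V → Packing (Fin 0) V E
  packing-∅ ¬v = record
    { copy = λ () ; copy-edge = λ () ; copy-injective = λ () ; copy-cover = ⊥-elim ∘ ¬v }

  adj⇒≢ : ∀ {x y} → adj H x y ≡ true → x ≢ y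
  adj⇒≢ {x} xy refl with () ← trans (sym xy) (irrefl H x)

  closed⇒lookup≡ : {p : Subset (order H)} → (∀ {x y} → adj H x y ≡ true → x ∈ p → y ∈ p) →
    ∀ {x y} → adj H x y ≡ true → lookup p x ≡ lookup p y
  closed⇒lookup≡ {p} closed {x} {y} xy = ⇔→≡ (mk⇔
    (λ px → []=⇒lookup (closed xy (lookup⇒[]= x p px)))
    (λ py → []=⇒lookup (closed (trans (adj-sym H y x) xy) (lookup⇒[]= y p py))))

  hasNeighbourIn : Subset (order H) → Fin (order H) → Bool
  hasNeighbourIn p u = any (λ w → lookup p w ∧ adj H w u) (allFin (order H))

  reachStep : Subset (order H) → Subset (order H)
  reachStep p = tabulate λ u → lookup p u ∨ hasNeighbourIn p u

  reachStep-inflationary : ∀ p → p ⊆ reachStep p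
  reachStep-inflationary p {x} x∈p = ∈-tabulate⁺ (cong (_∨ hasNeighbourIn p x) ([]=⇒lookup x∈p))

  reachStep-adj : ∀ {p x y} → x ∈ p → adj H x y ≡ true → y ∈ reachStep p
  reachStep-adj {p} {x} {y} x∈p xy =
    ∈-tabulate⁺ (trans (cong (lookup p y ∨_) y-neighbour) (∨-zeroʳ _))
    where
    y-neighbour : hasNeighbourIn p y ≡ true
    y-neighbour = Equivalence.to T-≡ (any⁺ _ (lose (∈-allFin x)
      (Equivalence.from T-≡ (cong₂ _∧_ ([]=⇒lookup x∈p) xy))))

  reaches : Fin (order H) → ℕ → Subset (order H)
  reaches v k = tabulate (reach H k v)

  reaches-suc : ∀ v k → reaches v (suc k) ≡ reachStep (reaches v k)
  reaches-suc v k = tabulate-cong λ u → cong₂ _∨_ (sym (lookup∘tabulate _ u))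
    (cong or (map-cong (λ w → cong (_∧ adj H w u) (sym (lookup∘tabulate _ w))) (allFin (order H))))

  component : Fin (order H) → Subset (order H)
  component v = reaches v (order H)

  componentOrder≡∣component∣ : ∀ v → componentOrder H v ≡ ∣ component v ∣ˢ
  componentOrder≡∣component∣ v = length-filterᵇ-tabulate (connected H v) id

  component-closed : ∀ {v x y} → adj H x y ≡ true → x ∈ component v → y ∈ component v
  component-closed {v} {x} {y} xy x∈C = subst (y ∈_) (sym component≡) (reachStep-adj x∈C xy)
    where
    v∈reaches₀ : v ∈ reaches v 0
    v∈reaches₀ = ∈-tabulate⁺ (Equivalence.to T-≡ (ℕ.≡⇒≡ᵇ (toℕ v) (toℕ v) refl))
    component≡ : component v ≡ reachStep (component v)
    component≡ = trans
      (iterate-stabilises reachStep reachStep-inflationary (reaches v) (reaches-suc v) v∈reaches₀)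
      (reaches-suc v (order H))

  Packable : ℕ → ℕ → Set
  Packable m₁ m₂ = Σ ℕ λ k → Packing (Fin k) (TwoCliques m₁ m₂) twoCliquesAdj

  packable-0 : Packable 0 0
  packable-0 = 0 , packing-∅ [ (λ ()) , (λ ()) ]′

  packable-+ : Packable a b → Packable a′ b′ → Packable (a ℕ.+ a′) (b ℕ.+ b′)
  packable-+ (k , P) (l , Q) = k ℕ.+ l ,
    packing-map twoCliques-+↔ twoCliquesAdj-+↔ (packing-reindex (↔-sym +↔⊎) (packing-⊎ P Q))

  packable-swap : Packable a b → Packable b a
  packable-swap (k , P) = k , packing-map (⊎-comm _ _) twoCliquesAdj-swap P

  packable-closed : (p : Subset (order H)) → (∀ {x y} → adj H x y ≡ true → x ∈ p → y ∈ p) →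
    Packable ∣ p ∣ˢ ∣ ∁ p ∣ˢ
  packable-closed p closed = 1 , packing-map (partition p) edge packing-self
    where
    edge : ∀ {x y} → adj H x y ≡ true → twoCliquesAdj (to (partition p) x) (to (partition p) y)
    edge {x} {y} xy = sameSide⇒twoCliquesAdj _ _
      (trans (side-partition p x) (trans (closed⇒lookup≡ closed xy) (sym (side-partition p y))))
      (adj⇒≢ xy ∘ ↔-injective (partition p))

  -- Clique orders are read in ℤ so that D - s below needs no truncated subtraction.
  Packableᶻ : ℤ → ℤ → Set
  Packableᶻ i j = Σ ℕ λ m₁ → Σ ℕ λ m₂ → + m₁ ≡ i × + m₂ ≡ j × Packable m₁ m₂

  packableᶻ-+ : Packableᶻ i j → Packableᶻ i′ j′ → Packableᶻ (i + i′) (j + j′)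
  packableᶻ-+ (m₁ , m₂ , refl , refl , P) (m₁′ , m₂′ , refl , refl , P′) =
    m₁ ℕ.+ m₁′ , m₂ ℕ.+ m₂′ , pos-+ m₁ m₁′ , pos-+ m₂ m₂′ , packable-+ P P′

  packableᶻ-swap : Packableᶻ i j → Packableᶻ j i
  packableᶻ-swap (m₁ , m₂ , e₁ , e₂ , P) = m₂ , m₁ , e₂ , e₁ , packable-swap P

  packableᶻ-closed : (p : Subset (order H)) → (∀ {x y} → adj H x y ≡ true → x ∈ p → y ∈ p) →
    Packableᶻ (+ ∣ p ∣ˢ) (+ order H - + ∣ p ∣ˢ)
  packableᶻ-closed p closed = _ , _ , refl , +∣∁p∣≡n-∣p∣ p , packable-closed p closed

  packableᶻ-full : Packableᶻ (+ order H) 0ℤ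
  packableᶻ-full = subst (Packableᶻ _) (ℤ.+-inverseʳ (+ order H))
    (subst (λ m → Packableᶻ (+ m) (+ order H - + m)) (∣⊤∣≡n _)
      (packableᶻ-closed Subset.⊤ (λ _ _ → ∈⊤)))

  packableᶻ-component : ∀ v → Packableᶻ (+ componentOrder H v) (+ order H - + componentOrder H v)
  packableᶻ-component v =
    subst (λ m → Packableᶻ (+ m) (+ order H - + m)) (sym (componentOrder≡∣component∣ v))
      (packableᶻ-closed (component v) component-closed)

  record PackableAround (D : ℕ) (s : ℤ) : Set where
    constructor packableAround
    field packableᶻ : Packableᶻ (+ D + s) (+ D - s)

  around-0 : PackableAround 0 0ℤ
  around-0 = packableAround (0 , 0 , refl , refl , packable-0)

  around-+ : PackableAround D s → PackableAround D′ s′ → PackableAround (D ℕ.+ D′) (s + s′)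
  around-+ {D} {s} {D′} {s′} (packableAround P) (packableAround Q) =
    packableAround $ subst₂ Packableᶻ
    (trans (interchange⁺ (+ D) s (+ D′) s′) (cong (_+ (s + s′)) (sym (pos-+ D D′))))
    (trans (interchange⁻ (+ D) s (+ D′) s′) (cong (_- (s + s′)) (sym (pos-+ D D′))))
    (packableᶻ-+ P Q)
    where
    interchange⁺ : ∀ x u y v → (x + u) + (y + v) ≡ (x + y) + (u + v)
    interchange⁺ = solve-∀
    interchange⁻ : ∀ x u y v → (x - u) + (y - v) ≡ (x + y) - (u + v)
    interchange⁻ = solve-∀

  around-neg : PackableAround D s → PackableAround D (- s)
  around-neg {D} {s} (packableAround P) =
    packableAround $
      subst (Packableᶻ _) (cong (_+_ (+ D)) (sym (neg-involutive s))) (packableᶻ-swap P)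

  around-* : ∀ k → PackableAround D s → PackableAround (k ℕ.* D) (+ k * s)
  around-* zero    _ = around-0
  around-* (suc k) P = subst (PackableAround _) (sym (suc-* (+ k) _)) (around-+ P (around-* k P))

  around-pad : PackableAround (order H) 0ℤ
  around-pad = packableAround $
    subst (Packableᶻ _) (sym (ℤ.+-identityʳ _))
      (packableᶻ-+ packableᶻ-full (packableᶻ-swap packableᶻ-full))

  around-component : ∀ v → PackableAround (order H) (+ componentOrder H v)
  around-component v = packableAround $
    subst (Packableᶻ _) (ℤ.+-identityˡ _) (packableᶻ-+ packableᶻ-full (packableᶻ-component v))

  Attainable : ℤ → Set
  Attainable s = Σ ℕ λ D → order H ∣ D × PackableAround D s

  attainable-hcf : Attainable (+ hcf-c H)
  attainable-hcf = subgroup-foldr-gcd Attainable (0 , _ ∣0 , around-0)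
    (λ (D , ∣D , P) (D′ , ∣D′ , Q) → D ℕ.+ D′ , ∣m∣n⇒∣m+n ∣D ∣D′ , around-+ P Q)
    (Product.map₂ (Product.map₂ around-neg))
    (map⁺ (All.universal (λ v → order H , ∣-refl , around-component v) (allFin (order H))))

  around-scale : PackableAround D 1ℤ → ∀ s → PackableAround (∣ s ∣ ℕ.* D) s
  around-scale P (+ k)    = subst (PackableAround _) (ℤ.*-identityʳ (+ k)) (around-* k P)
  around-scale P -[1+ k ] = subst (PackableAround _) (cong -_ (ℤ.*-identityʳ (+ suc k)))
    (around-neg (around-* (suc k) P))

  around-pad-multiple : order H ∣ D → PackableAround D 0ℤ
  around-pad-multiple (divides r refl) =
    subst (PackableAround _) (ℤ.*-zeroʳ (+ r)) (around-* r around-pad)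

  around-extend : PackableAround D s → D ≤ D′ → order H ∣ D → order H ∣ D′ → PackableAround D′ s
  around-extend {D} {s} {D′} P D≤D′ ∣D ∣D′ =
    subst₂ PackableAround (m+[n∸m]≡n D≤D′) (ℤ.+-identityʳ s) (around-+ P (around-pad-multiple ∣gap))
    where
    ∣gap : order H ∣ D′ ∸ D
    ∣gap = ∣m+n∣m⇒∣n (subst (order H ∣_) (sym (m+[n∸m]≡n D≤D′)) ∣D′) ∣D

  around⇒perfectPacking : PackableAround D s → + m₁ ≡ + D + s → + m₂ ≡ + D - s →
    PerfectPacking H (TwoCliques m₁ m₂) twoCliquesAdj
  around⇒perfectPacking (packableAround (_ , _ , e₁ , e₂ , _ , P)) e₁′ e₂′ =
    subst₂ (λ m₁ m₂ → PerfectPacking H (TwoCliques m₁ m₂) twoCliquesAdj)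
      (+-injective (trans e₁ (sym e₁′))) (+-injective (trans e₂ (sym e₂′)))
      (packing⇒perfectPacking P)

lemma17 : (H : Graph) → χ≡ H 2 → hcf-c H ≡ 1 →
    Σ ℕ λ D₀ → (D′ : ℕ) → D′ ≥ D₀ → order H ∣ D′ →
    (a : ℤ) → ∣ a ∣ ≤ bottleOrder H →
    (m₁ m₂ : ℕ) → + m₁ ≡ + D′ + a → + m₂ ≡ + D′ - a →
    PerfectPacking H (TwoCliques m₁ m₂) twoCliquesAdj
lemma17 H _ hcf≡1 =
  let D₁ , ∣D₁ , P₁ = subst (Attainable H) (cong +_ hcf≡1) (attainable-hcf H) in
  order H ℕ.* D₁ , λ D′ D₀≤D′ ∣D′ a ∣a∣≤∣H∣ m₁ m₂ m₁≡ m₂≡ →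
    let ∣a∣D₁≤D′ = ≤-trans (*-monoˡ-≤ D₁ ∣a∣≤∣H∣) D₀≤D′ in
    around⇒perfectPacking H
      (around-extend H (around-scale H P₁ a) ∣a∣D₁≤D′ (∣n⇒∣m*n ∣ a ∣ ∣D₁) ∣D′) m₁≡ m₂≡
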